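{- Let $f:B\to A$ and $g:C\to A$ be two covers, and let $B\xleftarrow{p}U\xrightarrow{q}C$ be a pullback of $B\xrightarrow{f}A\xleftarrow{g}C$. Two arrows $i,j\in\Sigma(U)$ are equal if and only if there exists a cover $u:{\rm dom}\,i\to{\rm dom}\,j$ such that $p\circ j\circ u=p\circ i$ and $q\circ j\circ u=q\circ i$.
   Context: Let $\mathbf C$ be a category and $\mathbf D$ a full subcategory of $\mathbf C$. For arrows $f,g$ of $\mathbf C$ with ${\rm cod}\,f={\rm cod}\,g$, ${\rm Hom}(g,f)$ denotes the collection of all arrows $h$ of $\mathbf C$ with $g=f\circ h$. Standing assumptions: (G1) every diagram $B\to A\leftarrow C$ in $\mathbf D$ has a pullback in $\mathbf C$. (G2) (I) pushouts exist in $\mathbf D$; (II) every arrow of $\mathbf D$ is epic; (III) every monic arrow of $\mathbf D$ is an isomorphism whose inverse is an arrow of $\mathbf D$. (G3) for every object $U$ of $\mathbf C$ there is a set $\Sigma(U)$ of arrows $i$ of $\mathbf C$ with ${\rm dom}\,i$ in $\mathbf D$ and ${\rm cod}\,i=U$ such that for every arrow $u$ of $\mathbf C$ with ${\rm dom}\,u$ in $\mathbf D$ and ${\rm cod}\,u=U$ there is exactly one $i\in\Sigma(U)$ with ${\rm Hom}(u,i)\neq\emptyset$. (G4) there is a function $\deg$ from the collection of arrows of $\mathbf C$ whose codomain lies in $\mathbf D$ to the positive integers such that (I) $\deg(g\circ f)=\deg g\cdot\deg f$ whenever $f,g,g\circ f$ all lie in this collection; (II) $\deg f=\sum_{i\in\Sigma({\rm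 dom}\,f)}\deg(f\circ i)$ for every such $f$; (III) if $B\xrightarrow{f}A\xleftarrow{g}C$ is a diagram in $\mathbf D$ with pullback $B\xleftarrow{p}U\xrightarrow{q}C$, then $\deg f=\deg q$ and $\deg g=\deg p$. A cover is an arrow of $\mathbf D$. -}

module Defs where

open import Level using (Level; _⊔_; suc)
open import Data.Nat using (ℕ; _≤_; _*_)
open import Data.List using (List; map)
open import Data.Nat.ListAction using (sum)
open import Data.List.Membership.Propositional using (_∈_)
open import Data.List.Relation.Unary.Unique.Propositional using (Unique)
open import Data.Product using (Σ; Σ-syntax; ∃; ∃-syntax; _×_; _,_; proj₁; proj₂)
open import Function.Bundles using (_⇔_)
open import Relation.Binary.PropositionalEquality using (_≡_)

record Category (o ℓ : Level) : Set (suc (o ⊔ ℓ)) where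
  infixr 9 _∘_
  field
    Obj   : Set o
    Hom   : Obj → Obj → Set ℓ
    id    : ∀ {A} → Hom A A
    _∘_   : ∀ {A B C} → Hom B C → Hom A B → Hom A C
    assoc : ∀ {A B C D} (h : Hom C D) (g : Hom B C) (f : Hom A B) →
            (h ∘ g) ∘ f ≡ h ∘ (g ∘ f)
    idˡ   : ∀ {A B} (f : Hom A B) → id ∘ f ≡ f
    idʳ   : ∀ {A B} (f : Hom A B) → f ∘ id ≡ f

module _ {o ℓ : Level} (𝐂 : Category o ℓ) where
  open Category 𝐂

  ∃!' : ∀ {a b} {A : Set a} → (A → Set b) → Set (a ⊔ b)
  ∃!' {A = A} P = Σ[ x ∈ A ] (P x × (∀ y → P y → x ≡ y))

  record IsPullback {A B C U : Obj} (f : Hom B A) (g : Hom C A)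
                    (p : Hom U B) (q : Hom U C) : Set (o ⊔ ℓ) where
    field
      commutes  : f ∘ p ≡ g ∘ q
      universal : ∀ {W} (a : Hom W B) (b : Hom W C) → f ∘ a ≡ g ∘ b →
                  ∃!' (λ (h : Hom W U) → (p ∘ h ≡ a) × (q ∘ h ≡ b))

  record Pullback {A B C : Obj} (f : Hom B A) (g : Hom C A) : Set (o ⊔ ℓ) where
    field
      U   : Obj
      p   : Hom U B
      q   : Hom U C
      isPullback : IsPullback f g p q

  -- Galois-category data: C together with a full subcategory D (given by a
  -- predicate on objects), satisfying the standing assumptions (G1)-(G4).
  record GaloisData (d s : Level) : Set (o ⊔ ℓ ⊔ suc d ⊔ suc s) where
    field
      inD : Obj → Set d

      G1 : ∀ {A B C} → inD A → inD B → inD C →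
           (f : Hom B A) (g : Hom C A) → Pullback f g

      G2-I : ∀ {A B C} → inD A → inD B → inD C →
             (f : Hom A B) (g : Hom A C) →
             Σ[ P ∈ Obj ] Σ[ i₁ ∈ Hom B P ] Σ[ i₂ ∈ Hom C P ]
               (inD P × (i₁ ∘ f ≡ i₂ ∘ g) ×
                (∀ {W} → inD W → (a : Hom B W) (b : Hom C W) → a ∘ f ≡ b ∘ g →
                  ∃!' (λ (h : Hom P W) → (h ∘ i₁ ≡ a) × (h ∘ i₂ ≡ b))))

      G2-II : ∀ {X Y} → inD X → inD Y → (f : Hom X Y) →
              ∀ {W} → inD W → (a b : Hom Y W) → a ∘ f ≡ b ∘ f → a ≡ b

      -- (G2)(III) every monic arrow of D is an isomorphism with inverse in D
      -- (the inverse is automatically in D since D is full)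
      G2-III : ∀ {X Y} → inD X → inD Y → (f : Hom X Y) →
               (∀ {W} → inD W → (a b : Hom W X) → f ∘ a ≡ f ∘ b → a ≡ b) →
               Σ[ g ∈ Hom Y X ] ((g ∘ f ≡ id) × (f ∘ g ≡ id))

      -- (G3) the sets Σ(U), given as a membership predicate on arrows into U
      Sig     : (U : Obj) → (X : Obj) → Hom X U → Set s
      Sig-dom : ∀ {U X} {i : Hom X U} → Sig U X i → inD X
      G3 : ∀ {U X} → inD X → (u : Hom X U) →
           Σ[ Y ∈ Obj ] Σ[ i ∈ Hom Y U ] (Sig U Y i × ∃[ h ] (i ∘ h ≡ u) ×
             (∀ Y' (i' : Hom Y' U) → Sig U Y' i' → ∃[ h' ] (i' ∘ h' ≡ u) →
                _≡_ {A = Σ Obj (λ Z → Hom Z U)} (Y , i) (Y' , i')))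

      -- (G4) degree; only its values on arrows with codomain in D matter
      deg     : ∀ {X Y} → Hom X Y → ℕ
      deg-pos : ∀ {X Y} → inD Y → (f : Hom X Y) → 1 ≤ deg f
      G4-I    : ∀ {X Y Z} → inD Y → inD Z → (f : Hom X Y) (g : Hom Y Z) →
                deg (g ∘ f) ≡ deg g * deg f
      G4-II   : ∀ {U Y} → inD Y → (f : Hom U Y) →
                Σ[ l ∈ List (Σ Obj (λ Z → Hom Z U)) ]
                  (Unique l ×
                   (∀ Z (i : Hom Z U) → ((Z , i) ∈ l) ⇔ Sig U Z i) ×
                   (deg f ≡ sum (map (λ zi → deg (f ∘ proj₂ zi)) l)))
      G4-III  : ∀ {A B C U} → inD A → inD B → inD C →
                (f : Hom B A) (g : Hom C A) (p : Hom U B) (q : Hom U C) →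
                IsPullback f g p q → (deg f ≡ deg q) × (deg g ≡ deg p)

{-# OPTIONS --safe #-}
-- Joint monicity of the pullback projections turns the two equations into
-- j ∘ u ≡ i, so i factors through j; by (G3) the element of Σ(U) through which
-- i factors is unique, and i factors through itself, hence i = j.  In
-- particular u need not be assumed to be a cover.
module Submission where

open import Defs
open import Level using (Level)
open import Data.Product using (Σ; ∃-syntax; _×_; _,_)
open import Function.Bundles using (_⇔_; mk⇔)
open import Relation.Binary.PropositionalEquality
  using (_≡_; refl; sym; trans; cong; module ≡-Reasoning)
open Category using (Obj; Hom)
open GaloisData using (inD; Sig)

module _ {o ℓ : Level} (𝐂 : Category o ℓ) where
  open Category 𝐂 using (_∘_; id; assoc; idʳ)

  IsPullback-commutes-∘ :
    ∀ {A B C U W} {f : Hom 𝐂 B A} {g : Hom 𝐂 C A} {p : Hom 𝐂 U B} {q : Hom 𝐂 U C} →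
    IsPullback 𝐂 f g p q → (b : Hom 𝐂 W U) → f ∘ (p ∘ b) ≡ g ∘ (q ∘ b)
  IsPullback-commutes-∘ {f = f} {g} {p} {q} pb b = begin
    f ∘ (p ∘ b)  ≡⟨ sym (assoc f p b) ⟩
    (f ∘ p) ∘ b  ≡⟨ cong (_∘ b) (IsPullback.commutes pb) ⟩
    (g ∘ q) ∘ b  ≡⟨ assoc g q b ⟩
    g ∘ (q ∘ b)  ∎
    where open ≡-Reasoning

  IsPullback-jointlyMonic :
    ∀ {A B C U W} {f : Hom 𝐂 B A} {g : Hom 𝐂 C A} {p : Hom 𝐂 U B} {q : Hom 𝐂 U C} →
    IsPullback 𝐂 f g p q → (a b : Hom 𝐂 W U) →
    p ∘ a ≡ p ∘ b → q ∘ a ≡ q ∘ b → a ≡ b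
  IsPullback-jointlyMonic {p = p} {q} pb a b pa≡pb qa≡qb
    with IsPullback.universal pb (p ∘ b) (q ∘ b) (IsPullback-commutes-∘ pb b)
  ... | _ , _ , unique = trans (sym (unique a (pa≡pb , qa≡qb))) (unique b (refl , refl))

  Sig-factor-unique :
    ∀ {d s} (G : GaloisData 𝐂 d s) {U X Y} {i : Hom 𝐂 X U} {j : Hom 𝐂 Y U} →
    Sig G U X i → Sig G U Y j → (u : Hom 𝐂 X Y) → j ∘ u ≡ i →
    _≡_ {A = Σ (Obj 𝐂) (λ Z → Hom 𝐂 Z U)} (X , i) (Y , j)
  Sig-factor-unique G {X = X} {Y} {i} {j} si sj u ju≡i
    with GaloisData.G3 G (GaloisData.Sig-dom G si) i
  ... | _ , _ , _ , _ , _ , unique =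
    trans (sym (unique X i si (id , idʳ i))) (unique Y j sj (u , ju≡i))

lemma3p9 : ∀ {o ℓ d s : Level} (𝐂 : Category o ℓ) (G : GaloisData 𝐂 d s) →
    ∀ {A B C U : Obj 𝐂} → inD G A → inD G B → inD G C →
    (f : Hom 𝐂 B A) (g : Hom 𝐂 C A) (p : Hom 𝐂 U B) (q : Hom 𝐂 U C) →
    IsPullback 𝐂 f g p q →
    ∀ {X Y : Obj 𝐂} (i : Hom 𝐂 X U) (j : Hom 𝐂 Y U) → Sig G U X i → Sig G U Y j →
    (_≡_ {A = Σ (Obj 𝐂) (λ Z → Hom 𝐂 Z U)} (X , i) (Y , j)
      ⇔ (∃[ u ] ((Category._∘_ 𝐂 p (Category._∘_ 𝐂 j u) ≡ Category._∘_ 𝐂 p i)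
               × (Category._∘_ 𝐂 q (Category._∘_ 𝐂 j u) ≡ Category._∘_ 𝐂 q i))))
lemma3p9 𝐂 G _ _ _ _ _ p q pb i j si sj = mk⇔ identity-witnesses factor-equal
  where
  open Category 𝐂 using (_∘_; id; idʳ)
  identity-witnesses : (_ , i) ≡ (_ , j) →
    ∃[ u ] ((p ∘ (j ∘ u) ≡ p ∘ i) × (q ∘ (j ∘ u) ≡ q ∘ i))
  identity-witnesses refl = id , cong (p ∘_) (idʳ i) , cong (q ∘_) (idʳ i)
  factor-equal : ∃[ u ] ((p ∘ (j ∘ u) ≡ p ∘ i) × (q ∘ (j ∘ u) ≡ q ∘ i)) →
    (_ , i) ≡ (_ , j)
  factor-equal (u , pju≡pi , qju≡qi) =
    Sig-factor-unique 𝐂 G si sj u (IsPullback-jointlyMonic 𝐂 pb (j ∘ u) i pju≡pi qju≡qi)
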